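{- Let $n\ge1$, $O=\{0,1,\dots,n-1\}$ with its usual order, and let $\mathfrak r$ be the rank function of the finite distributive lattice $\mathscr E_O$. Then for every nonempty interval $[\ell..r]\subseteq O$, \[\mathfrak r(\{[\ell..r]\})=(1+\ell)(n-r).\] Moreover, if $k>0$ and $X=\{[\ell_0..r_0],\dots,[\ell_k..r_k]\}\in\mathscr E_O$ with $\ell_0<\ell_1<\cdots<\ell_k$, then \[\mathfrak r(X)=(1+\ell_0)(n-r_0)+\sum_{i=1}^k(\ell_i-\ell_{i-1})(n-r_i).\]
   Context: An interval of $O$ is a set of consecutive elements $[\ell..r]=\{x:\ell\le x\le r\}$ (or $\emptyset$). $\mathscr E_O$ is the set of antichains with respect to inclusion of intervals of $O$, ordered by $A\le B$ iff for every $I\in A$ there is $J\in B$ with $J\subseteq I$; it is a finite distributive lattice with bottom $\emptyset$. The rank function $\mathfrak r:\mathscr E_O\to\mathbf N$ is the function with $\mathfrak r(0)=0$ and $\mathfrak r(x)=\mathfrak r(y)+1$ whenever $x$ covers $y$. -}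

module Defs where

open import Data.Nat using (ℕ; zero; suc; _≤_; _<_)
open import Data.Bool using (Bool; true; false)
open import Data.Empty using (⊥)
open import Data.Product using (Σ; _×_; _,_)
open import Relation.Nullary using (¬_)
open import Relation.Binary.PropositionalEquality using (_≡_)

data Interval (n : ℕ) : Set where
  ∅ᵢ : Interval n
  iv : (ℓ r : ℕ) → ℓ ≤ r → r < n → Interval n

_∈ᵢ_ : {n : ℕ} → ℕ → Interval n → Set
x ∈ᵢ ∅ᵢ = ⊥
x ∈ᵢ iv ℓ r _ _ = ℓ ≤ x × x ≤ r

_⊆ᵢ_ : {n : ℕ} → Interval n → Interval n → Set
I ⊆ᵢ J = ∀ x → x ∈ᵢ I → x ∈ᵢ J

_≃ᵢ_ : {n : ℕ} → Interval n → Interval n → Set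
I ≃ᵢ J = (I ⊆ᵢ J) × (J ⊆ᵢ I)

-- Elements of 𝓔_O: (finite, decidable) sets of intervals that are antichains
-- w.r.t. inclusion (whenever I ⊆ J for members I, J, they are the same set).
record Antichain (n : ℕ) : Set where
  field
    mem  : Interval n → Bool
    anti : ∀ I J → mem I ≡ true → mem J ≡ true → I ⊆ᵢ J → J ⊆ᵢ I

open Antichain public

_≼_ : {n : ℕ} → Antichain n → Antichain n → Set
A ≼ B = ∀ I → mem A I ≡ true → Σ (Interval _) (λ J → (mem B J ≡ true) × (J ⊆ᵢ I))

_≺_ : {n : ℕ} → Antichain n → Antichain n → Set
A ≺ B = (A ≼ B) × ¬ (B ≼ A)

_⋖_ : {n : ℕ} → Antichain n → Antichain n → Set
y ⋖ x = (y ≺ x) × (∀ z → y ≺ z → ¬ (z ≺ x))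

IsEmpty : {n : ℕ} → Antichain n → Set
IsEmpty A = ∀ I → mem A I ≡ false

IsRankFunction : {n : ℕ} → (Antichain n → ℕ) → Set
IsRankFunction rk =
  (∀ A → IsEmpty A → rk A ≡ 0) × (∀ x y → y ⋖ x → rk x ≡ suc (rk y))

-- The rank of X is the number ∣↑ X ∣ of intervals lying above X, i.e. containing some member of X
-- (the empty interval is an interval too). This count is strictly monotone in ≼, and replacing X by
-- the minimal elements of ↑ X ∖ {J}, for a member J, lowers it by exactly one; the result is therefore
-- covered by X, and every rank function agrees with ∣↑_∣ by induction on ∣↑ X ∣.
-- For X = {[ℓᵢ..rᵢ]} with ℓ increasing (hence r increasing, X being an antichain), [a..b] lies above X
-- iff a ≤ ℓᵢ and rᵢ ≤ b for some i. Peeling off the first interval, the intervals above it but above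
-- none of the others are those with a ≤ ℓ₀ and r₀ ≤ b < r₁, which produces the telescoping sum.
module Submission where

open import Algebra.Properties.CommutativeSemigroup using (interchange)
open import Data.Bool using (true) renaming (_≟_ to _≟ᵇ_)
open import Data.Bool.Properties using (¬-not)
open import Data.Empty using (⊥; ⊥-elim)
open import Data.Fin using (Fin; inject₁) renaming (zero to fzero; suc to fsuc)
open import Data.Fin.Properties using (any?)
open import Data.List using (tabulate)
open import Data.Nat using (ℕ; zero; suc; _+_; _*_; _∸_; _⊓_; _≤_; _<_; z≤n; s≤s; s≤s⁻¹; _≤?_; _<?_)
open import Data.Nat.Induction using (<-wellFounded)
open import Data.Nat.ListAction using (sum)
open import Data.Nat.Properties
open import Data.Nat.Tactic.RingSolver using (solve-∀)
open import Data.Product using (∃; _×_; _,_; proj₁; proj₂)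
open import Data.Sum using (_⊎_; inj₁; inj₂; [_,_])
import Data.Sum as Sum
open import Function.Base using (_∘_)
open import Function.Bundles using (_⇔_; Equivalence; mk⇔)
open import Induction.WellFounded using (WellFounded; Acc; acc; module Subrelation)
open import Level using (Level; 0ℓ)
import Relation.Binary.Construct.On as On
open import Relation.Binary.PropositionalEquality
  using (_≡_; _≢_; refl; sym; trans; cong; cong₂; subst; module ≡-Reasoning)
open import Relation.Nullary using (Dec; yes; no; ¬_; contradiction; _×-dec_; _⊎-dec_; map′)
open import Relation.Nullary.Decidable using (does; dec-true; decidable-stable; ¬?; toSum)
open import Relation.Unary using (Pred; Decidable; _⊆_; _≐_; _∪_; _∩_; ∁; Empty)
open import Relation.Unary.Properties using (_∩?_; ∁?)

open import Defs

private
  variable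
    a b c : Level
    A : Set a
    B : Set b
    C : Set c
    n k : ℕ

𝟙 : Dec A → ℕ
𝟙 (yes _) = 1
𝟙 (no _)  = 0

𝟙-mono : (A → B) → (a? : Dec A) (b? : Dec B) → 𝟙 a? ≤ 𝟙 b?
𝟙-mono f (yes x) (yes _) = ≤-refl
𝟙-mono f (yes x) (no ¬y) = contradiction (f x) ¬y
𝟙-mono f (no _)  _       = z≤n

𝟙-strict : ¬ A → B → (a? : Dec A) (b? : Dec B) → 𝟙 a? < 𝟙 b?
𝟙-strict ¬x y (yes x) _       = contradiction x ¬x
𝟙-strict ¬x y (no _)  (yes _) = s≤s z≤n
𝟙-strict ¬x y (no _)  (no ¬y) = contradiction y ¬y

𝟙-cong : A ⇔ B → (a? : Dec A) (b? : Dec B) → 𝟙 a? ≡ 𝟙 b?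
𝟙-cong A⇔B a? b? =
  ≤-antisym (𝟙-mono (Equivalence.to A⇔B) a? b?) (𝟙-mono (Equivalence.from A⇔B) b? a?)

𝟙-× : (a? : Dec A) (b? : Dec B) → 𝟙 (a? ×-dec b?) ≡ 𝟙 a? * 𝟙 b?
𝟙-× (yes _) (yes _) = refl
𝟙-× (yes _) (no _)  = refl
𝟙-× (no _)  _       = refl

𝟙-split : A ⇔ (B ⊎ C) → ¬ (B × C) →
          (a? : Dec A) (b? : Dec B) (c? : Dec C) → 𝟙 a? ≡ 𝟙 b? + 𝟙 c?
𝟙-split _      disj (yes _) (yes y) (yes z) = contradiction (y , z) disj
𝟙-split _      _    (yes _) (yes _) (no _)  = refl
𝟙-split _      _    (yes _) (no _)  (yes _) = refl
𝟙-split A⇔B⊎C _    (yes x) (no ¬y) (no ¬z) = ⊥-elim ([ ¬y , ¬z ] (Equivalence.to A⇔B⊎C x))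
𝟙-split A⇔B⊎C _    (no ¬x) (yes y) _       = contradiction (Equivalence.from A⇔B⊎C (inj₁ y)) ¬x
𝟙-split A⇔B⊎C _    (no ¬x) (no _)  (yes z) = contradiction (Equivalence.from A⇔B⊎C (inj₂ z)) ¬x
𝟙-split _      _    (no _)  (no _)  (no _)  = refl

does-true⇒ : (a? : Dec A) → does a? ≡ true → A
does-true⇒ (yes a) _ = a

𝟙-no : (a? : Dec A) → ¬ A → 𝟙 a? ≡ 0
𝟙-no (yes x) ¬x = contradiction x ¬x
𝟙-no (no _)  ¬x = refl

𝟙-yes : (a? : Dec A) → A → 𝟙 a? ≡ 1
𝟙-yes (yes _) x = refl
𝟙-yes (no ¬x) x = contradiction x ¬x

∑< : ℕ → (ℕ → ℕ) → ℕ
∑< zero    f = 0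
∑< (suc m) f = ∑< m f + f m

syntax ∑< m (λ x → e) = ∑[ x < m ] e

module _ {f g : ℕ → ℕ} where

  ∑-cong : ∀ m → (∀ x → x < m → f x ≡ g x) → ∑< m f ≡ ∑< m g
  ∑-cong zero    f≡g = refl
  ∑-cong (suc m) f≡g = cong₂ _+_ (∑-cong m λ x x<m → f≡g x (m<n⇒m<1+n x<m)) (f≡g m ≤-refl)

  ∑-mono : ∀ m → (∀ x → f x ≤ g x) → ∑< m f ≤ ∑< m g
  ∑-mono zero    f≤g = z≤n
  ∑-mono (suc m) f≤g = +-mono-≤ (∑-mono m f≤g) (f≤g m)

  ∑-strict : ∀ m → (∀ x → f x ≤ g x) → ∀ {y} → y < m → f y < g y → ∑< m f < ∑< m g
  ∑-strict (suc m) f≤g y<1+m fy<gy with m≤n⇒m<n∨m≡n (s≤s⁻¹ y<1+m)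
  ... | inj₁ y<m  = +-mono-<-≤ (∑-strict m f≤g y<m fy<gy) (f≤g m)
  ... | inj₂ refl = +-mono-≤-< (∑-mono m f≤g) fy<gy

  ∑-distrib-+ : ∀ m → ∑[ x < m ] (f x + g x) ≡ ∑< m f + ∑< m g
  ∑-distrib-+ zero    = refl
  ∑-distrib-+ (suc m) = trans (cong (_+ (f m + g m)) (∑-distrib-+ m))
                              (interchange +-commutativeSemigroup (∑< m f) (∑< m g) (f m) (g m))

∑-zero : ∀ m {f} → (∀ x → x < m → f x ≡ 0) → ∑< m f ≡ 0
∑-zero zero    f≡0 = refl
∑-zero (suc m) f≡0 = cong₂ _+_ (∑-zero m λ x x<m → f≡0 x (m<n⇒m<1+n x<m)) (f≡0 m ≤-refl)

∑-single : ∀ m {f y} → y < m → (∀ x → x < m → x ≢ y → f x ≡ 0) → ∑< m f ≡ f y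
∑-single (suc m) {f} {y} y<1+m others with m≤n⇒m<n∨m≡n (s≤s⁻¹ y<1+m)
... | inj₁ y<m  = begin
  ∑< m f + f m ≡⟨ cong₂ _+_ (∑-single m y<m λ x x<m → others x (m<n⇒m<1+n x<m))
                            (others m ≤-refl λ { refl → <-irrefl refl y<m }) ⟩
  f y + 0      ≡⟨ +-identityʳ (f y) ⟩
  f y          ∎
  where open ≡-Reasoning
... | inj₂ refl =
  cong (_+ f m) (∑-zero m λ x x<m → others x (m<n⇒m<1+n x<m) λ { refl → <-irrefl refl x<m })

∑-*ʳ : ∀ m f c → ∑[ x < m ] (f x * c) ≡ ∑< m f * c
∑-*ʳ zero    f c = refl
∑-*ʳ (suc m) f c = trans (cong (_+ f m * c) (∑-*ʳ m f c)) (sym (*-distribʳ-+ c (∑< m f) (f m)))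

∑-*ˡ : ∀ m f c → ∑[ x < m ] (c * f x) ≡ c * ∑< m f
∑-*ˡ zero    f c = sym (*-zeroʳ c)
∑-*ˡ (suc m) f c = trans (cong (_+ c * f m) (∑-*ˡ m f c)) (sym (*-distribˡ-+ c (∑< m f) (f m)))

∑∑-separable : ∀ m m′ f g → ∑[ x < m ] ∑[ y < m′ ] (f x * g y) ≡ ∑< m f * ∑< m′ g
∑∑-separable m m′ f g = trans (∑-cong m λ x _ → ∑-*ˡ m′ g (f x)) (∑-*ʳ m f (∑< m′ g))

∑-𝟙-≤ : ∀ m c → ∑[ x < m ] 𝟙 (x ≤? c) ≡ m ⊓ suc c
∑-𝟙-≤ zero    c = refl
∑-𝟙-≤ (suc m) c with m ≤? c
... | yes m≤c = trans (cong (_+ 1) (trans (∑-𝟙-≤ m c) (m≤n⇒m⊓n≡m (m≤n⇒m≤1+n m≤c))))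
                      (trans (+-comm m 1) (sym (m≤n⇒m⊓n≡m (s≤s m≤c))))
... | no  m≰c = trans (+-identityʳ _) (trans (trans (∑-𝟙-≤ m c) (m≥n⇒m⊓n≡n c<m))
                                              (sym (m≥n⇒m⊓n≡n (m≤n⇒m≤1+n c<m))))
  where c<m = ≰⇒> m≰c

∑-𝟙-≥ : ∀ m c → ∑[ x < m ] 𝟙 (c ≤? x) ≡ m ∸ c
∑-𝟙-≥ zero    c = sym (0∸n≡0 c)
∑-𝟙-≥ (suc m) c with c ≤? m
... | yes c≤m = trans (cong (_+ 1) (∑-𝟙-≥ m c)) (trans (+-comm (m ∸ c) 1) (sym (+-∸-assoc 1 c≤m)))
... | no  c≰m = trans (+-identityʳ _) (trans (∑-𝟙-≥ m c) (trans (m≤n⇒m∸n≡0 (<⇒≤ m<c))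
                                                                 (sym (m≤n⇒m∸n≡0 m<c))))
  where m<c = ≰⇒> c≰m

∑∑-𝟙-× : ∀ m m′ {A B : ℕ → Set} (A? : ∀ x → Dec (A x)) (B? : ∀ y → Dec (B y)) →
         ∑[ x < m ] ∑[ y < m′ ] 𝟙 (A? x ×-dec B? y) ≡
         ∑[ x < m ] 𝟙 (A? x) * ∑[ y < m′ ] 𝟙 (B? y)
∑∑-𝟙-× m m′ A? B? =
  trans (∑-cong m λ x _ → ∑-cong m′ λ y _ → 𝟙-× (A? x) (B? y)) (∑∑-separable m m′ (𝟙 ∘ A?) (𝟙 ∘ B?))

∑-𝟙-≤-below : ∀ {m c} → c < m → ∑[ x < m ] 𝟙 (x ≤? c) ≡ suc c
∑-𝟙-≤-below {m} {c} c<m = trans (∑-𝟙-≤ m c) (m≥n⇒m⊓n≡n c<m)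

∑∑-rectangle : ∀ {m c} d → c < m → ∑[ x < m ] ∑[ y < m ] 𝟙 (x ≤? c ×-dec d ≤? y) ≡ suc c * (m ∸ d)
∑∑-rectangle {m} {c} d c<m =
  trans (∑∑-𝟙-× m m (_≤? c) (d ≤?_)) (cong₂ _*_ (∑-𝟙-≤-below c<m) (∑-𝟙-≥ m d))

⊆ᵢ-refl : {I : Interval n} → I ⊆ᵢ I
⊆ᵢ-refl x x∈I = x∈I

⊆ᵢ-trans : {I J K : Interval n} → I ⊆ᵢ J → J ⊆ᵢ K → I ⊆ᵢ K
⊆ᵢ-trans I⊆J J⊆K x x∈I = J⊆K x (I⊆J x x∈I)

≃ᵢ-refl : {I : Interval n} → I ≃ᵢ I
≃ᵢ-refl = ⊆ᵢ-refl , ⊆ᵢ-refl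

iv-irrelevant : ∀ {a b} {p p′ : a ≤ b} {q q′ : b < n} → iv a b p q ≡ iv a b p′ q′
iv-irrelevant {p = p} {p′} {q} {q′} = cong₂ (iv _ _) (≤-irrelevant p p′) (≤-irrelevant q q′)

module _ {a b c d} (p : a ≤ b) (q : b < n) (p′ : c ≤ d) (q′ : d < n) where

  iv⊆iv⇒ : iv a b p q ⊆ᵢ iv c d p′ q′ → c ≤ a × b ≤ d
  iv⊆iv⇒ I⊆J = proj₁ (I⊆J a (≤-refl , p)) , proj₂ (I⊆J b (p , ≤-refl))

  iv⊆iv⇐ : c ≤ a × b ≤ d → iv a b p q ⊆ᵢ iv c d p′ q′
  iv⊆iv⇐ (c≤a , b≤d) x (a≤x , x≤b) = ≤-trans c≤a a≤x , ≤-trans x≤b b≤d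

iv≃iv⇒≡ : ∀ {a b c d} (p : a ≤ b) (q : b < n) (p′ : c ≤ d) (q′ : d < n) →
          iv a b p q ≃ᵢ iv c d p′ q′ → a ≡ c × b ≡ d
iv≃iv⇒≡ p q p′ q′ (I⊆J , J⊆I) with iv⊆iv⇒ p q p′ q′ I⊆J | iv⊆iv⇒ p′ q′ p q J⊆I
... | c≤a , b≤d | a≤c , d≤b = ≤-antisym a≤c c≤a , ≤-antisym b≤d d≤b

_⊆ᵢ?_ : (I J : Interval n) → Dec (I ⊆ᵢ J)
∅ᵢ          ⊆ᵢ? J            = yes λ _ ()
iv a b p q  ⊆ᵢ? ∅ᵢ           = no λ I⊆∅ → I⊆∅ a (≤-refl , p)
iv a b p q  ⊆ᵢ? iv c d p′ q′ = map′ (iv⊆iv⇐ p q p′ q′) (iv⊆iv⇒ p q p′ q′) (c ≤? a ×-dec b ≤? d)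

_≃ᵢ?_ : (I J : Interval n) → Dec (I ≃ᵢ J)
I ≃ᵢ? J = (I ⊆ᵢ? J) ×-dec (J ⊆ᵢ? I)

-- Summing over all a, b < n counts every nonempty interval of P exactly once, the bound proofs
-- being irrelevant.
record Endpoints {n} (P : Pred (Interval n) c) (a b : ℕ) : Set c where
  constructor ⟨_,_,_⟩
  field
    a≤b   : a ≤ b
    b<n   : b < n
    holds : P (iv a b a≤b b<n)

module _ {P : Pred (Interval n) c} where

  endpoints? : Decidable P → ∀ a b → Dec (Endpoints P a b)
  endpoints? P? a b with a ≤? b | b <? n
  ... | no a≰b | _      = no (a≰b ∘ Endpoints.a≤b)
  ... | yes _  | no b≮n = no (b≮n ∘ Endpoints.b<n)
  ... | yes p  | yes q  = map′ ⟨ p , q ,_⟩ (λ (⟨ _ , _ , x ⟩) → subst P iv-irrelevant x) (P? (iv a b p q))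

  ¬endpoints : ∀ {a b p q} → ¬ P (iv a b p q) → ¬ Endpoints P a b
  ¬endpoints ¬x ⟨ _ , _ , x ⟩ = ¬x (subst P iv-irrelevant x)

  endpoints-map : {Q : Pred (Interval n) b} → P ⊆ Q → ∀ {a b} → Endpoints P a b → Endpoints Q a b
  endpoints-map P⊆Q ⟨ p , q , x ⟩ = ⟨ p , q , P⊆Q x ⟩

  anyInterval? : Decidable P → Dec (∃ P)
  anyInterval? P? = map′ witness search (P? ∅ᵢ ⊎-dec anyUpTo? (λ a → anyUpTo? (endpoints? P? a) n) n)
    where
    witness : P ∅ᵢ ⊎ ∃ (λ a → a < n × ∃ λ b → b < n × Endpoints P a b) → ∃ P
    witness (inj₁ x)                             = ∅ᵢ , x
    witness (inj₂ (a , _ , b , _ , ⟨ p , q , x ⟩)) = iv a b p q , x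
    search : ∃ P → P ∅ᵢ ⊎ ∃ (λ a → a < n × ∃ λ b → b < n × Endpoints P a b)
    search (∅ᵢ , x)         = inj₁ x
    search (iv a b p q , x) = inj₂ (a , ≤-<-trans p q , b , q , ⟨ p , q , x ⟩)

count : {P : Pred (Interval n) c} → Decidable P → ℕ
count {n = n} P? = 𝟙 (P? ∅ᵢ) + ∑[ a < n ] ∑[ b < n ] 𝟙 (endpoints? P? a b)

module _ {P : Pred (Interval n) a} {Q : Pred (Interval n) b} (P? : Decidable P) (Q? : Decidable Q)
         (P⊆Q : P ⊆ Q) where

  private
    entry-mono : ∀ a b → 𝟙 (endpoints? P? a b) ≤ 𝟙 (endpoints? Q? a b)
    entry-mono a b = 𝟙-mono (endpoints-map P⊆Q) (endpoints? P? a b) (endpoints? Q? a b)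

    rows-mono : ∀ a → ∑[ b < n ] 𝟙 (endpoints? P? a b) ≤ ∑[ b < n ] 𝟙 (endpoints? Q? a b)
    rows-mono a = ∑-mono n (entry-mono a)

  count-mono : count P? ≤ count Q?
  count-mono = +-mono-≤ (𝟙-mono P⊆Q (P? ∅ᵢ) (Q? ∅ᵢ)) (∑-mono n rows-mono)

  count-strict : ∀ {I} → Q I → ¬ P I → count P? < count Q?
  count-strict {∅ᵢ} y ¬x = +-mono-<-≤ (𝟙-strict ¬x y (P? ∅ᵢ) (Q? ∅ᵢ)) (∑-mono n rows-mono)
  count-strict {iv a b p q} y ¬x =
    +-mono-≤-< (𝟙-mono P⊆Q (P? ∅ᵢ) (Q? ∅ᵢ))
      (∑-strict n rows-mono (≤-<-trans p q)
        (∑-strict n (entry-mono a) q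
          (𝟙-strict (¬endpoints ¬x) ⟨ p , q , y ⟩ (endpoints? P? a b) (endpoints? Q? a b))))

count-cong : {P : Pred (Interval n) a} {Q : Pred (Interval n) b} (P? : Decidable P) (Q? : Decidable Q) →
             P ≐ Q → count P? ≡ count Q?
count-cong P? Q? (P⊆Q , Q⊆P) = ≤-antisym (count-mono P? Q? P⊆Q) (count-mono Q? P? Q⊆P)

module _ {P : Pred (Interval n) a} {Q : Pred (Interval n) b} {R : Pred (Interval n) c}
         (P? : Decidable P) (Q? : Decidable Q) (R? : Decidable R)
         (P≐Q∪R : P ≐ (Q ∪ R)) (Q∩R-empty : Empty (Q ∩ R)) where

  private
    entry-split : ∀ a b → 𝟙 (endpoints? P? a b) ≡ 𝟙 (endpoints? Q? a b) + 𝟙 (endpoints? R? a b)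
    entry-split a b =
      𝟙-split (mk⇔ to from) disjoint (endpoints? P? a b) (endpoints? Q? a b) (endpoints? R? a b)
      where
      to : Endpoints P a b → Endpoints Q a b ⊎ Endpoints R a b
      to ⟨ p , q , x ⟩ = Sum.map ⟨ p , q ,_⟩ ⟨ p , q ,_⟩ (proj₁ P≐Q∪R x)
      from : Endpoints Q a b ⊎ Endpoints R a b → Endpoints P a b
      from = [ endpoints-map (proj₂ P≐Q∪R ∘ inj₁) , endpoints-map (proj₂ P≐Q∪R ∘ inj₂) ]
      disjoint : ¬ (Endpoints Q a b × Endpoints R a b)
      disjoint (⟨ p , q , y ⟩ , ⟨ _ , _ , z ⟩) = Q∩R-empty (iv a b p q) (y , subst R iv-irrelevant z)

  count-split : count P? ≡ count Q? + count R?
  count-split =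
    trans (cong₂ _+_ (𝟙-split (mk⇔ (proj₁ P≐Q∪R) (proj₂ P≐Q∪R)) (Q∩R-empty ∅ᵢ) (P? ∅ᵢ) (Q? ∅ᵢ) (R? ∅ᵢ))
                     (trans (∑-cong n λ a _ → trans (∑-cong n λ b _ → entry-split a b) (∑-distrib-+ n))
                            (∑-distrib-+ n)))
          (interchange +-commutativeSemigroup (𝟙 (Q? ∅ᵢ)) (𝟙 (R? ∅ᵢ)) _ _)

count-empty : {P : Pred (Interval n) a} (P? : Decidable P) → Empty P → count P? ≡ 0
count-empty {n = n} P? P-empty =
  cong₂ _+_ (𝟙-no (P? ∅ᵢ) (P-empty ∅ᵢ))
            (∑-zero n λ a _ → ∑-zero n λ b _ →
               𝟙-no (endpoints? P? a b) λ (⟨ p , q , x ⟩) → P-empty (iv a b p q) x)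

count-≃ᵢ : (J : Interval n) → count (_≃ᵢ? J) ≡ 1
count-≃ᵢ {n = n} ∅ᵢ =
  cong₂ _+_ (𝟙-yes (∅ᵢ {n} ≃ᵢ? ∅ᵢ) (≃ᵢ-refl {I = ∅ᵢ {n}}))
            (∑-zero n λ a _ → ∑-zero n λ b _ →
               𝟙-no (endpoints? (_≃ᵢ? ∅ᵢ) a b) λ (⟨ p , _ , (I⊆∅ , _) ⟩) → I⊆∅ a (≤-refl , p))
count-≃ᵢ {n = n} J@(iv c d p q) =
  cong₂ _+_ (𝟙-no (∅ᵢ ≃ᵢ? J) (λ (_ , J⊆∅) → J⊆∅ c (≤-refl , p)))
            (trans (∑-single n (≤-<-trans p q) other-row) row-c)
  where
  endpoints≡ : ∀ {a b} → Endpoints (_≃ᵢ J) a b → a ≡ c × b ≡ d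
  endpoints≡ ⟨ p′ , q′ , I≃J ⟩ = iv≃iv⇒≡ p′ q′ p q I≃J

  other-row : ∀ a → a < n → a ≢ c → ∑[ b < n ] 𝟙 (endpoints? (_≃ᵢ? J) a b) ≡ 0
  other-row a _ a≢c = ∑-zero n λ b _ → 𝟙-no (endpoints? (_≃ᵢ? J) a b) (a≢c ∘ proj₁ ∘ endpoints≡)

  row-c : ∑[ b < n ] 𝟙 (endpoints? (_≃ᵢ? J) c b) ≡ 1
  row-c = trans (∑-single n q λ b _ b≢d → 𝟙-no (endpoints? (_≃ᵢ? J) c b) (b≢d ∘ proj₂ ∘ endpoints≡))
                (𝟙-yes (endpoints? (_≃ᵢ? J) c d) ⟨ p , q , ≃ᵢ-refl {I = J} ⟩)

_⊂ᵢ_ : Interval n → Interval n → Set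
I ⊂ᵢ J = I ⊆ᵢ J × ¬ (J ⊆ᵢ I)

_⊂ᵢ?_ : (I J : Interval n) → Dec (I ⊂ᵢ J)
I ⊂ᵢ? J = (I ⊆ᵢ? J) ×-dec ¬? (J ⊆ᵢ? I)

-- A strict subinterval has strictly fewer subintervals.
⊂ᵢ-wellFounded : WellFounded (_⊂ᵢ_ {n})
⊂ᵢ-wellFounded = Subrelation.wellFounded fewer-subintervals
                   (On.wellFounded (λ I → count (_⊆ᵢ? I)) <-wellFounded)
  where
  fewer-subintervals : ∀ {I J} → I ⊂ᵢ J → count (_⊆ᵢ? I) < count (_⊆ᵢ? J)
  fewer-subintervals {I} {J} (I⊆J , J⊈I) =
    count-strict (_⊆ᵢ? I) (_⊆ᵢ? J) (λ K⊆I → ⊆ᵢ-trans K⊆I I⊆J) (⊆ᵢ-refl {I = J}) J⊈I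

_∈_ : Interval n → Antichain n → Set
I ∈ X = mem X I ≡ true

_∈?_ : (I : Interval n) (X : Antichain n) → Dec (I ∈ X)
I ∈? X = mem X I ≟ᵇ true

↑ : Antichain n → Pred (Interval n) 0ℓ
↑ X I = ∃ λ J → J ∈ X × J ⊆ᵢ I

↑? : (X : Antichain n) → Decidable (↑ X)
↑? X I = anyInterval? λ J → J ∈? X ×-dec J ⊆ᵢ? I

∣↑_∣ : Antichain n → ℕ
∣↑ X ∣ = count (↑? X)

module _ {V : Pred (Interval n) a} (V? : Decidable V) where

  Minimal : Pred (Interval n) a
  Minimal I = V I × ¬ ∃ (λ J → V J × J ⊂ᵢ I)

  minimal? : Decidable Minimal
  minimal? I = V? I ×-dec ¬? (anyInterval? λ J → V? J ×-dec J ⊂ᵢ? I)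

  minimal-below : ∀ {I} → V I → ∃ λ J → Minimal J × J ⊆ᵢ I
  minimal-below {I} = go I (⊂ᵢ-wellFounded I)
    where
    go : ∀ I → Acc _⊂ᵢ_ I → V I → ∃ λ J → Minimal J × J ⊆ᵢ I
    go I (acc smaller) VI with anyInterval? (λ J → V? J ×-dec J ⊂ᵢ? I)
    ... | no  none               = I , (VI , none) , ⊆ᵢ-refl {I = I}
    ... | yes (J , VJ , J⊂I) with go J (smaller J⊂I) VJ
    ...   | K , minK , K⊆J = K , minK , ⊆ᵢ-trans K⊆J (proj₁ J⊂I)

  minimals : Antichain n
  minimals = record { mem = does ∘ minimal? ; anti = anti′ }
    where
    anti′ : ∀ I J → does (minimal? I) ≡ true → does (minimal? J) ≡ true → I ⊆ᵢ J → J ⊆ᵢ I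
    anti′ I J I∈ J∈ I⊆J = decidable-stable (J ⊆ᵢ? I) λ J⊈I →
      proj₂ (does-true⇒ (minimal? J) J∈) (I , proj₁ (does-true⇒ (minimal? I) I∈) , I⊆J , J⊈I)

  ↑-minimals : (∀ {I K} → V I → I ⊆ᵢ K → V K) → ↑ minimals ≐ V
  ↑-minimals V-upward =
      (λ (J , J∈ , J⊆I) → V-upward (proj₁ (does-true⇒ (minimal? J) J∈)) J⊆I)
    , (λ VI → let (J , minJ , J⊆I) = minimal-below VI in J , dec-true (minimal? J) minJ , J⊆I)

module _ (A B : Antichain n) where

  ≼⇒↑⊆↑ : A ≼ B → ↑ A ⊆ ↑ B
  ≼⇒↑⊆↑ A≼B (J , J∈A , J⊆I) with A≼B J J∈A
  ... | K , K∈B , K⊆J = K , K∈B , ⊆ᵢ-trans K⊆J J⊆I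

  ↑⊆↑⇒≼ : ↑ A ⊆ ↑ B → A ≼ B
  ↑⊆↑⇒≼ ↑A⊆↑B I I∈A = ↑A⊆↑B (I , I∈A , ⊆ᵢ-refl {I = I})

  ∣↑∣-mono : A ≼ B → ∣↑ A ∣ ≤ ∣↑ B ∣
  ∣↑∣-mono A≼B = count-mono (↑? A) (↑? B) (≼⇒↑⊆↑ A≼B)

  ∣↑∣-strict : A ≺ B → ∣↑ A ∣ < ∣↑ B ∣
  ∣↑∣-strict (A≼B , B⋠A) with anyInterval? (λ J → J ∈? B ×-dec ¬? (↑? A J))
  ... | yes (J , J∈B , J∉↑A) = count-strict (↑? A) (↑? B) (≼⇒↑⊆↑ A≼B) (J , J∈B , ⊆ᵢ-refl {I = J}) J∉↑A
  ... | no  none             =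
    contradiction (λ J J∈B → decidable-stable (↑? A J) λ J∉↑A → none (J , J∈B , J∉↑A)) B⋠A

∣↑∣-empty : (X : Antichain n) → IsEmpty X → ∣↑ X ∣ ≡ 0
∣↑∣-empty X X-empty =
  count-empty (↑? X) λ I (J , J∈X , _) → contradiction (trans (sym (X-empty J)) J∈X) λ ()

⋖-if-∣↑∣≡suc : (Y X : Antichain n) → Y ≼ X → ∣↑ X ∣ ≡ suc ∣↑ Y ∣ → Y ⋖ X
⋖-if-∣↑∣≡suc Y X Y≼X ∣↑X∣≡1+∣↑Y∣ = (Y≼X , X⋠Y) , nothing-between
  where
  X⋠Y : ¬ (X ≼ Y)
  X⋠Y X≼Y = 1+n≰n (subst (_≤ ∣↑ Y ∣) ∣↑X∣≡1+∣↑Y∣ (∣↑∣-mono X Y X≼Y))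
  nothing-between : ∀ Z → Y ≺ Z → ¬ (Z ≺ X)
  nothing-between Z Y≺Z Z≺X =
    1+n≰n (≤-trans (∣↑∣-strict Y Z Y≺Z) (s≤s⁻¹ (subst (∣↑ Z ∣ <_) ∣↑X∣≡1+∣↑Y∣ (∣↑∣-strict Z X Z≺X))))

module Removal (X : Antichain n) (J : Interval n) (J∈X : J ∈ X) where

  Rest : Pred (Interval n) 0ℓ
  Rest = ↑ X ∩ ∁ (_≃ᵢ J)

  rest? : Decidable Rest
  rest? = ↑? X ∩? ∁? (_≃ᵢ? J)

  -- J is minimal in ↑ X, so removing it leaves an up-set.
  Rest-upward : ∀ {I K} → Rest I → I ⊆ᵢ K → Rest K
  Rest-upward ((J′ , J′∈X , J′⊆I) , I≄J) I⊆K =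
    (J′ , J′∈X , ⊆ᵢ-trans J′⊆I I⊆K) , λ (K⊆J , J⊆K) →
      let I⊆J = ⊆ᵢ-trans I⊆K K⊆J
      in I≄J (I⊆J , ⊆ᵢ-trans (anti X J′ J J′∈X J∈X (⊆ᵢ-trans J′⊆I I⊆J)) J′⊆I)

  X∖J : Antichain n
  X∖J = minimals rest?

  ↑X∖J≐Rest : ↑ X∖J ≐ Rest
  ↑X∖J≐Rest = ↑-minimals rest? Rest-upward

  X∖J≼X : X∖J ≼ X
  X∖J≼X = ↑⊆↑⇒≼ X∖J X (proj₁ ∘ proj₁ ↑X∖J≐Rest)

  ∣↑X∣≡1+∣↑X∖J∣ : ∣↑ X ∣ ≡ suc ∣↑ X∖J ∣
  ∣↑X∣≡1+∣↑X∖J∣ = begin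
    ∣↑ X ∣                        ≡⟨ count-split (↑? X) rest? (_≃ᵢ? J) ↑X≐Rest∪≃J disjoint ⟩
    count rest? + count (_≃ᵢ? J)  ≡⟨ cong₂ _+_ (sym (count-cong (↑? X∖J) rest? ↑X∖J≐Rest)) (count-≃ᵢ J) ⟩
    ∣↑ X∖J ∣ + 1                  ≡⟨ +-comm ∣↑ X∖J ∣ 1 ⟩
    suc ∣↑ X∖J ∣                  ∎
    where
    open ≡-Reasoning
    ↑X≐Rest∪≃J : ↑ X ≐ (Rest ∪ (_≃ᵢ J))
    ↑X≐Rest∪≃J = split , [ proj₁ , (λ (_ , J⊆I) → J , J∈X , J⊆I) ]
      where
      split : ∀ {I} → ↑ X I → (Rest ∪ (_≃ᵢ J)) I
      split {I} ↑XI with I ≃ᵢ? J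
      ... | yes I≃J = inj₂ I≃J
      ... | no  I≄J = inj₁ (↑XI , I≄J)
    disjoint : Empty (Rest ∩ (_≃ᵢ J))
    disjoint I ((_ , I≄J) , I≃J) = I≄J I≃J

  X∖J⋖X : X∖J ⋖ X
  X∖J⋖X = ⋖-if-∣↑∣≡suc X∖J X X∖J≼X ∣↑X∣≡1+∣↑X∖J∣

rank≡∣↑∣ : (rk : Antichain n → ℕ) → IsRankFunction rk → ∀ X → rk X ≡ ∣↑ X ∣
rank≡∣↑∣ rk (rk-bottom , rk-cover) X = by-count ∣↑ X ∣ X refl
  where
  by-count : ∀ m X → ∣↑ X ∣ ≡ m → rk X ≡ m
  by-count m X ∣↑X∣≡m with anyInterval? (_∈? X)
  ... | no X-has-none = trans (rk-bottom X X-empty) (trans (sym (∣↑∣-empty X X-empty)) ∣↑X∣≡m)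
    where
    X-empty : IsEmpty X
    X-empty I = ¬-not λ I∈X → X-has-none (I , I∈X)
  by-count zero X ∣↑X∣≡0 | yes (J , J∈X) = contradiction (trans (sym ∣↑X∣≡1+∣↑X∖J∣) ∣↑X∣≡0) λ ()
    where open Removal X J J∈X
  by-count (suc m) X ∣↑X∣≡1+m | yes (J , J∈X) = begin
    rk X          ≡⟨ rk-cover X X∖J X∖J⋖X ⟩
    suc (rk X∖J)  ≡⟨ cong suc (by-count m X∖J (suc-injective (trans (sym ∣↑X∣≡1+∣↑X∖J∣) ∣↑X∣≡1+m))) ⟩
    suc m         ∎
    where open Removal X J J∈X
          open ≡-Reasoning

WithEndpoints : (ℕ → ℕ → Set) → Pred (Interval n) 0ℓ
WithEndpoints R ∅ᵢ           = ⊥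
WithEndpoints R (iv a b _ _) = R a b

module _ {R : ℕ → ℕ → Set} (R? : ∀ a b → Dec (R a b)) where

  withEndpoints? : Decidable (WithEndpoints {n = n} R)
  withEndpoints? ∅ᵢ           = no λ ()
  withEndpoints? (iv a b _ _) = R? a b

  count-withEndpoints : (∀ {a b} → R a b → a ≤ b) →
                        count (withEndpoints? {n = n}) ≡ ∑[ a < n ] ∑[ b < n ] 𝟙 (R? a b)
  count-withEndpoints {n = n} R⇒≤ = ∑-cong n λ a _ → ∑-cong n λ b b<n →
    𝟙-cong (mk⇔ Endpoints.holds λ Rab → ⟨ R⇒≤ Rab , b<n , Rab ⟩)
           (endpoints? withEndpoints? a b) (R? a b)

Covers : (ℓ r : Fin (suc k) → ℕ) → ℕ → ℕ → Set
Covers ℓ r a b = ∃ λ i → a ≤ ℓ i × r i ≤ b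

covers? : (ℓ r : Fin (suc k) → ℕ) → ∀ a b → Dec (Covers ℓ r a b)
covers? ℓ r a b = any? λ i → a ≤? ℓ i ×-dec r i ≤? b

rankFormula : (n k : ℕ) (ℓ r : Fin (suc k) → ℕ) → ℕ
rankFormula n k ℓ r = suc (ℓ fzero) * (n ∸ r fzero)
  + sum (tabulate (λ (i : Fin k) → (ℓ (fsuc i) ∸ ℓ (inject₁ i)) * (n ∸ r (fsuc i))))

Increasing : (Fin (suc k) → ℕ) → Set
Increasing {k} f = ∀ (i : Fin k) → f (inject₁ i) ≤ f (fsuc i)

increasing-≥-head : (f : Fin (suc k) → ℕ) → Increasing f → ∀ i → f fzero ≤ f i
increasing-≥-head         f f↑ fzero    = ≤-refl
increasing-≥-head {suc k} f f↑ (fsuc i) = ≤-trans (f↑ fzero) (increasing-≥-head (f ∘ fsuc) (f↑ ∘ fsuc) i)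

module FirstInterval (ℓ r : Fin (suc (suc k)) → ℕ) (ℓ↑ : Increasing ℓ) (r↑ : Increasing r) where

  ℓ′ r′ : Fin (suc k) → ℕ
  ℓ′ = ℓ ∘ fsuc
  r′ = r ∘ fsuc

  ℓ₀ ℓ₁ r₀ r₁ : ℕ
  ℓ₀ = ℓ fzero
  ℓ₁ = ℓ (fsuc fzero)
  r₀ = r fzero
  r₁ = r (fsuc fzero)

  -- right endpoints reached by the first interval but not by the later ones
  New : ℕ → Set
  New b = r₀ ≤ b × ¬ r₁ ≤ b

  new? : ∀ b → Dec (New b)
  new? b = r₀ ≤? b ×-dec ¬? (r₁ ≤? b)

  peel : ∀ {a b} → Covers ℓ r a b ⇔ (Covers ℓ′ r′ a b ⊎ (a ≤ ℓ₀ × New b))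
  peel {a} {b} = mk⇔ to [ (λ (i , h) → fsuc i , h) , (λ (a≤ℓ₀ , r₀≤b , _) → fzero , a≤ℓ₀ , r₀≤b) ]
    where
    to : Covers ℓ r a b → Covers ℓ′ r′ a b ⊎ (a ≤ ℓ₀ × New b)
    to (fsuc i , h) = inj₁ (i , h)
    to (fzero , a≤ℓ₀ , r₀≤b) with r₁ ≤? b
    ... | yes r₁≤b = inj₁ (fzero , ≤-trans a≤ℓ₀ (ℓ↑ fzero) , r₁≤b)
    ... | no  r₁≰b = inj₂ (a≤ℓ₀ , r₀≤b , r₁≰b)

  peel-disjoint : ∀ {a b} → ¬ (Covers ℓ′ r′ a b × (a ≤ ℓ₀ × New b))
  peel-disjoint ((i , _ , r′ᵢ≤b) , _ , _ , r₁≰b) =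
    r₁≰b (≤-trans (increasing-≥-head r′ (r↑ ∘ fsuc) i) r′ᵢ≤b)

  ∸-new : ∀ n → n ∸ r₀ ≡ (n ∸ r₁) + ∑[ b < n ] 𝟙 (new? b)
  ∸-new n = begin
    n ∸ r₀
      ≡⟨ ∑-𝟙-≥ n r₀ ⟨
    ∑[ b < n ] 𝟙 (r₀ ≤? b)
      ≡⟨ ∑-cong n (λ b _ → 𝟙-split split-r₀ disjoint (r₀ ≤? b) (r₁ ≤? b) (new? b)) ⟩
    ∑[ b < n ] (𝟙 (r₁ ≤? b) + 𝟙 (new? b))
      ≡⟨ ∑-distrib-+ n ⟩
    ∑[ b < n ] 𝟙 (r₁ ≤? b) + ∑[ b < n ] 𝟙 (new? b)
      ≡⟨ cong (_+ ∑[ b < n ] 𝟙 (new? b)) (∑-𝟙-≥ n r₁) ⟩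
    (n ∸ r₁) + ∑[ b < n ] 𝟙 (new? b) ∎
    where
    open ≡-Reasoning
    split-r₀ : ∀ {b} → r₀ ≤ b ⇔ (r₁ ≤ b ⊎ New b)
    split-r₀ {b} = mk⇔ (λ r₀≤b → Sum.map₂ (r₀≤b ,_) (toSum (r₁ ≤? b))) [ ≤-trans (r↑ fzero) , proj₁ ]
    disjoint : ∀ {b} → ¬ (r₁ ≤ b × New b)
    disjoint (r₁≤b , _ , r₁≰b) = r₁≰b r₁≤b

∑∑-covers : ∀ k (ℓ r : Fin (suc k) → ℕ) → Increasing ℓ → Increasing r → (∀ i → ℓ i < n) →
            ∑[ a < n ] ∑[ b < n ] 𝟙 (covers? ℓ r a b) ≡ rankFormula n k ℓ r
∑∑-covers {n} zero ℓ r _ _ ℓ<n = begin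
  ∑[ a < n ] ∑[ b < n ] 𝟙 (covers? ℓ r a b)
    ≡⟨ ∑-cong n (λ a _ → ∑-cong n λ b _ → 𝟙-cong only-one (covers? ℓ r a b) (a ≤? ℓ₀ ×-dec r₀ ≤? b)) ⟩
  ∑[ a < n ] ∑[ b < n ] 𝟙 (a ≤? ℓ₀ ×-dec r₀ ≤? b)
    ≡⟨ ∑∑-rectangle r₀ (ℓ<n fzero) ⟩
  suc ℓ₀ * (n ∸ r₀)
    ≡⟨ +-identityʳ _ ⟨
  rankFormula n zero ℓ r ∎
  where
  open ≡-Reasoning
  ℓ₀ = ℓ fzero
  r₀ = r fzero
  only-one : ∀ {a b} → Covers ℓ r a b ⇔ (a ≤ ℓ₀ × r₀ ≤ b)
  only-one = mk⇔ (λ { (fzero , h) → h ; (fsuc () , _) }) (fzero ,_)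
∑∑-covers {n} (suc k) ℓ r ℓ↑ r↑ ℓ<n = begin
  ∑[ a < n ] ∑[ b < n ] 𝟙 (covers? ℓ r a b)
    ≡⟨ ∑-cong n (λ a _ → trans (∑-cong n λ b _ → 𝟙-split peel peel-disjoint (covers? ℓ r a b)
                                                   (covers? ℓ′ r′ a b) (a ≤? ℓ₀ ×-dec new? b))
                               (∑-distrib-+ n)) ⟩
  ∑[ a < n ] (∑[ b < n ] 𝟙 (covers? ℓ′ r′ a b) + ∑[ b < n ] 𝟙 (a ≤? ℓ₀ ×-dec new? b))
    ≡⟨ ∑-distrib-+ n ⟩
  ∑[ a < n ] ∑[ b < n ] 𝟙 (covers? ℓ′ r′ a b) + ∑[ a < n ] ∑[ b < n ] 𝟙 (a ≤? ℓ₀ ×-dec new? b)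
    ≡⟨ cong₂ _+_ (∑∑-covers k ℓ′ r′ (ℓ↑ ∘ fsuc) (r↑ ∘ fsuc) (ℓ<n ∘ fsuc))
                 (∑∑-𝟙-× n n (_≤? ℓ₀) new?) ⟩
  rankFormula n k ℓ′ r′ + ∑[ a < n ] 𝟙 (a ≤? ℓ₀) * D
    ≡⟨ cong (λ x → rankFormula n k ℓ′ r′ + x * D) (∑-𝟙-≤-below (ℓ<n fzero)) ⟩
  suc ℓ₁ * (n ∸ r₁) + T + suc ℓ₀ * D
    ≡⟨ cong (λ x → suc x * (n ∸ r₁) + T + suc ℓ₀ * D) (m+[n∸m]≡n (ℓ↑ fzero)) ⟨
  suc (ℓ₀ + (ℓ₁ ∸ ℓ₀)) * (n ∸ r₁) + T + suc ℓ₀ * D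
    ≡⟨ regroup ℓ₀ (ℓ₁ ∸ ℓ₀) (n ∸ r₁) D T ⟩
  suc ℓ₀ * ((n ∸ r₁) + D) + ((ℓ₁ ∸ ℓ₀) * (n ∸ r₁) + T)
    ≡⟨ cong (λ x → suc ℓ₀ * x + ((ℓ₁ ∸ ℓ₀) * (n ∸ r₁) + T)) (∸-new n) ⟨
  rankFormula n (suc k) ℓ r ∎
  where
  open ≡-Reasoning
  open FirstInterval ℓ r ℓ↑ r↑
  D = ∑[ b < n ] 𝟙 (new? b)
  T = sum (tabulate (λ (i : Fin k) → (ℓ′ (fsuc i) ∸ ℓ′ (inject₁ i)) * (n ∸ r′ (fsuc i))))

  regroup : ∀ l e m d t → suc (l + e) * m + t + suc l * d ≡ suc l * (m + d) + (e * m + t)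
  regroup = solve-∀

module _ (ℓ r : Fin (suc k) → ℕ) (p : ∀ i → ℓ i ≤ r i) (q : ∀ i → r i < n)
         (ℓ< : ∀ (i : Fin k) → ℓ (inject₁ i) < ℓ (fsuc i))
         (X : Antichain n) (X≐ : ∀ I → (I ∈ X) ⇔ ∃ (λ i → I ≃ᵢ iv (ℓ i) (r i) (p i) (q i))) where

  private
    Jᵢ : Fin (suc k) → Interval n
    Jᵢ i = iv (ℓ i) (r i) (p i) (q i)

    Jᵢ∈X : ∀ i → Jᵢ i ∈ X
    Jᵢ∈X i = Equivalence.from (X≐ (Jᵢ i)) (i , ≃ᵢ-refl {I = Jᵢ i})

  -- If r decreased, Jᵢ₊₁ ⊆ Jᵢ, and the antichain property would force ℓᵢ₊₁ ≤ ℓᵢ.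
  r-increasing : Increasing r
  r-increasing i with r (inject₁ i) ≤? r (fsuc i)
  ... | yes rᵢ≤rᵢ₊₁ = rᵢ≤rᵢ₊₁
  ... | no  rᵢ≰rᵢ₊₁ = contradiction (proj₁ (iv⊆iv⇒ (p i′) (q i′) (p j) (q j) Jᵢ⊆Jᵢ₊₁)) (<⇒≱ (ℓ< i))
    where
    i′ = inject₁ i
    j  = fsuc i
    Jᵢ₊₁⊆Jᵢ : Jᵢ j ⊆ᵢ Jᵢ i′
    Jᵢ₊₁⊆Jᵢ = iv⊆iv⇐ (p j) (q j) (p i′) (q i′) (<⇒≤ (ℓ< i) , <⇒≤ (≰⇒> rᵢ≰rᵢ₊₁))
    Jᵢ⊆Jᵢ₊₁ : Jᵢ i′ ⊆ᵢ Jᵢ j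
    Jᵢ⊆Jᵢ₊₁ = anti X (Jᵢ j) (Jᵢ i′) (Jᵢ∈X j) (Jᵢ∈X i′) Jᵢ₊₁⊆Jᵢ

  ↑X≐covered : ↑ X ≐ WithEndpoints (Covers ℓ r)
  ↑X≐covered = covered , from-covered
    where
    covered : ∀ {I} → ↑ X I → WithEndpoints (Covers ℓ r) I
    covered {I} (J , J∈X , J⊆I) with Equivalence.to (X≐ J) J∈X
    covered {∅ᵢ}           (J , _ , J⊆∅) | i , _ , Jᵢ⊆J = J⊆∅ (ℓ i) (Jᵢ⊆J (ℓ i) (≤-refl , p i))
    covered {iv a b p′ q′} (J , _ , J⊆I) | i , _ , Jᵢ⊆J =
      i , iv⊆iv⇒ (p i) (q i) p′ q′ (⊆ᵢ-trans {I = Jᵢ i} {J} {iv a b p′ q′} Jᵢ⊆J J⊆I)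
    from-covered : ∀ {I} → WithEndpoints (Covers ℓ r) I → ↑ X I
    from-covered {iv a b p′ q′} (i , a≤ℓᵢ , rᵢ≤b) =
      Jᵢ i , Jᵢ∈X i , iv⊆iv⇐ (p i) (q i) p′ q′ (a≤ℓᵢ , rᵢ≤b)

  ∣↑∣-listed : ∣↑ X ∣ ≡ rankFormula n k ℓ r
  ∣↑∣-listed = begin
    ∣↑ X ∣                                     ≡⟨ count-cong (↑? X) covered? ↑X≐covered ⟩
    count covered?                             ≡⟨ count-withEndpoints (covers? ℓ r) {n = n} covers⇒≤ ⟩
    ∑[ a < n ] ∑[ b < n ] 𝟙 (covers? ℓ r a b)  ≡⟨ ∑∑-covers k ℓ r (<⇒≤ ∘ ℓ<) r-increasing ℓ<n ⟩
    rankFormula n k ℓ r                        ∎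
    where
    open ≡-Reasoning
    covered? : Decidable (WithEndpoints {n = n} (Covers ℓ r))
    covered? = withEndpoints? (covers? ℓ r)
    ℓ<n : ∀ i → ℓ i < n
    ℓ<n i = ≤-<-trans (p i) (q i)
    covers⇒≤ : ∀ {a b} → Covers ℓ r a b → a ≤ b
    covers⇒≤ (i , a≤ℓᵢ , rᵢ≤b) = ≤-trans a≤ℓᵢ (≤-trans (p i) rᵢ≤b)

theorem27 : (n : ℕ) → 1 ≤ n → (rk : Antichain n → ℕ) → IsRankFunction rk →
    ((ℓ r : ℕ) (p : ℓ ≤ r) (q : r < n) (X : Antichain n) →
      (∀ I → (mem X I ≡ true) ⇔ (I ≃ᵢ iv ℓ r p q)) →
      rk X ≡ suc ℓ * (n ∸ r))
    ×
    ((k : ℕ) → 0 < k → (ℓ r : Fin (suc k) → ℕ)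
      (p : ∀ i → ℓ i ≤ r i) (q : ∀ i → r i < n) →
      (∀ (i : Fin k) → ℓ (inject₁ i) < ℓ (fsuc i)) →
      (X : Antichain n) →
      (∀ I → (mem X I ≡ true) ⇔ ∃ (λ i → I ≃ᵢ iv (ℓ i) (r i) (p i) (q i))) →
      rk X ≡ suc (ℓ fzero) * (n ∸ r fzero)
             + sum (tabulate (λ (i : Fin k) → (ℓ (fsuc i) ∸ ℓ (inject₁ i)) * (n ∸ r (fsuc i)))))
theorem27 n _ rk rk-rank = singleton , λ k _ → listed k
  where
  listed : ∀ k (ℓ r : Fin (suc k) → ℕ) p q → (∀ (i : Fin k) → ℓ (inject₁ i) < ℓ (fsuc i)) → ∀ X →
           (∀ I → (I ∈ X) ⇔ ∃ (λ i → I ≃ᵢ iv (ℓ i) (r i) (p i) (q i))) → rk X ≡ rankFormula n k ℓ r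
  listed k ℓ r p q ℓ< X X≐ = trans (rank≡∣↑∣ rk rk-rank X) (∣↑∣-listed ℓ r p q ℓ< X X≐)

  singleton : ∀ ℓ r p q X → (∀ I → (I ∈ X) ⇔ (I ≃ᵢ iv ℓ r p q)) → rk X ≡ suc ℓ * (n ∸ r)
  singleton ℓ r p q X X≐ =
    trans (listed 0 (λ _ → ℓ) (λ _ → r) (λ _ → p) (λ _ → q) (λ ()) X
                  λ I → mk⇔ (λ I∈X → fzero , Equivalence.to (X≐ I) I∈X) (Equivalence.from (X≐ I) ∘ proj₂))
          (+-identityʳ (suc ℓ * (n ∸ r)))
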